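{- Let $G$ be a graph. If $v$ is a leaf of $G$ (a vertex of degree $1$) and $N(v)=\{w\}$, then $$\phi(G)\le \sum_{u\in N(w)\setminus\{v\}}\phi\big(G-(N[w]\cup N[u])\big)+\phi(G-\{v,w\})+\phi(G-N[w]).$$
   Context: All graphs are finite, simple, undirected. A subset of vertices $F$ of a graph $G$ is a dissociation set if the induced subgraph $G[F]$ has maximum degree at most $1$. A maximal dissociation set is a dissociation set that is not a proper subset of any other dissociation set. $\phi(G)$ denotes the number of maximal dissociation sets of $G$ (for the graph with no vertices, $\phi=1$). $N(v)$ is the neighborhood of $v$, $N[v]=N(v)\cup\{v\}$, and for $S\subseteq V(G)$, $G-S$ is the subgraph induced by $V(G)\setminus S$. -}

module Defs where

open import Data.Bool using (Bool; true; false; _∧_)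
open import Data.Nat using (ℕ; zero; suc; _≤_; _≤?_)
open import Data.Nat.ListAction using (sum)
open import Data.Fin using (Fin; _≟_)
open import Data.Fin.Properties using (all?)
open import Data.Fin.Subset using (Subset; inside; outside; _∈_; _⊆_; _∩_; _∪_; ∣_∣; ∁; ⁅_⁆; ⊤)
open import Data.Fin.Subset.Properties using (_⊆?_; _∈?_)
open import Data.List using (List; []; _∷_; _++_; map; filter; length; allFin)
open import Data.List.Relation.Unary.All using (All)
  renaming (all? to allL?)
open import Data.Vec using (Vec; []; _∷_; tabulate)
open import Data.Product using (_×_)
open import Relation.Nullary using (Dec; yes; no; ¬_; _×-dec_; _→-dec_; ¬?)
open import Relation.Binary.PropositionalEquality using (_≡_)

record Graph (n : ℕ) : Set where
  field
    adj     : Fin n → Fin n → Bool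
    symm    : ∀ u v → adj u v ≡ adj v u
    irrefl  : ∀ v → adj v v ≡ false

module _ {n : ℕ} (G : Graph n) where
  open Graph G

  N : Fin n → Subset n
  N v = tabulate (λ u → adj v u)

  N[_] : Fin n → Subset n
  N[ v ] = N v ∪ ⁅ v ⁆

  degree : Fin n → ℕ
  degree v = ∣ N v ∣

  -- We work with induced subgraphs G[W] (W ⊆ V(G)); G - S is G[∁ S].
  Dissociation : Subset n → Subset n → Set
  Dissociation W F = F ⊆ W × (∀ v → v ∈ F → ∣ F ∩ N v ∣ ≤ 1)

  dissociation? : ∀ W F → Dec (Dissociation W F)
  dissociation? W F =
    (F ⊆? W) ×-dec all? (λ v → (v ∈? F) →-dec (∣ F ∩ N v ∣ ≤? 1))

  allSubsets : (m : ℕ) → List (Subset m)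
  allSubsets zero    = [] ∷ []
  allSubsets (suc m) = map (inside ∷_) (allSubsets m) ++ map (outside ∷_) (allSubsets m)

  MaximalDissociation : Subset n → Subset n → Set
  MaximalDissociation W F =
    Dissociation W F ×
    All (λ F' → Dissociation W F' → F ⊆ F' → F' ⊆ F) (allSubsets n)

  maximalDissociation? : ∀ W F → Dec (MaximalDissociation W F)
  maximalDissociation? W F =
    dissociation? W F ×-dec
    allL? (λ F' → dissociation? W F' →-dec ((F ⊆? F') →-dec (F' ⊆? F))) (allSubsets n)

  φ : Subset n → ℕ
  φ W = length (filter (maximalDissociation? W) (allSubsets n))

  φ-del : Subset n → ℕ
  φ-del S = φ (∁ S)

{-# OPTIONS --safe #-}
module Submission where

-- Sort the maximal dissociation sets F of G by how they meet the edge vw.  If w ∉ F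
-- then v ∈ F, since otherwise v could be added, and F minus v is maximal in G - {v, w}.
-- If v, w ∈ F, they are each other's only neighbour in F, so F meets N[w] in {v, w}
-- and the rest of F is maximal in G - N[w].  If w ∈ F but v ∉ F, then w has a
-- neighbour u ≠ v in F (again since v cannot be added), and F minus {w, u} is maximal
-- in G - (N[w] ∪ N[u]).  In each class F is recovered from its restriction, so each
-- class injects into the maximal dissociation sets of the corresponding subgraph.

open import Defs
open import Data.Nat using (ℕ; zero; suc; _≤_; _<_; _+_; z≤n; s≤s)
open import Data.Nat.Properties
  using (≤-refl; ≤-trans; ≤-reflexive; <-irrefl; ≤-<-trans; <-≤-trans; n≤1+n; +-mono-≤; +-monoʳ-≤; +-monoˡ-≤; +-suc; module ≤-Reasoning)
open import Data.Nat.ListAction using (sum)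
open import Data.Bool using (true)
open import Data.Bool.Properties using () renaming (_≟_ to _≟ᵇ_)
open import Data.Fin using (Fin; _≟_)
open import Data.Fin.Subset
  using (Subset; inside; outside; _∈_; _∉_; _⊆_; _∩_; _∪_; ∁; ⁅_⁆; ∣_∣; ⊤; _-_)
open import Data.Fin.Subset.Properties
  using (_∈?_; nonempty?; Empty-unique; ∣⊥∣≡0; ∣⁅x⁆∣≡1; p⊆q⇒∣p∣≤∣q∣; x∈⁅x⁆; x∈⁅y⁆⇒x≡y;
         x∈p∧x≢y⇒x∈p-y; x∈p⇒∣p-x∣<∣p∣; ⊆-antisym; p⊆p∪q; q⊆p∪q; x∈p∪q⁺; x∈p∪q⁻;
         x∈p∩q⁺; x∈p∩q⁻; p∩q⊆p; p∩q⊆q; x∉p⇒x∈∁p; x∈∁p⇒x∉p; ⊆⊤)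
open import Data.List using (List; []; _∷_; map; filter; length; allFin)
open import Data.List.Properties using (length-removeAt′; filter-none)
open import Data.List.Membership.Propositional using () renaming (_∈_ to _∈ₗ_)
open import Data.List.Membership.Propositional.Properties
  using (∈-filter⁺; ∈-filter⁻; ∈-map⁺; ∈-map⁻; ∈-++⁺ˡ; ∈-++⁺ʳ; ∈-allFin)
open import Data.List.Relation.Unary.Any as Any using (Any; here; there; any?; index; _─_)
open import Data.List.Relation.Unary.All as All using (All)
open import Data.List.Relation.Unary.AllPairs using ([]; _∷_)
open import Data.List.Relation.Unary.Unique.Propositional using (Unique)
import Data.List.Relation.Unary.Unique.Propositional.Properties as Unique
open import Data.Vec using ([]; _∷_)
open import Data.Vec.Properties using (lookup∘tabulate; []=⇒lookup; lookup⇒[]=; ∷-injectiveʳ)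
open import Data.Product using (_×_; _,_; proj₁; proj₂)
open import Data.Sum using (_⊎_; inj₁; inj₂; [_,_]′)
open import Function using (_∘_; id)
open import Relation.Unary using (Decidable)
open import Relation.Nullary using (¬_; yes; no; ¬?; _×-dec_; _⊎-dec_; contradiction)
open import Relation.Binary.PropositionalEquality using (_≡_; _≢_; refl; sym; trans; cong; subst)

∈-─⁺ : {A : Set} {x z : A} {ys : List A} (p : x ∈ₗ ys) → z ∈ₗ ys → z ≢ x → z ∈ₗ (ys ─ p)
∈-─⁺ (here refl) (here refl) z≢x = contradiction refl z≢x
∈-─⁺ (here refl) (there q)   _   = q
∈-─⁺ (there p)   (here refl) _   = here refl
∈-─⁺ (there p)   (there q)   z≢x = there (∈-─⁺ p q z≢x)

module _ {A : Set} where

  length-≤-injection : {B : Set} (f : A → B) (xs : List A) {ys : List B} → Unique xs →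
    (∀ {a b} → a ∈ₗ xs → b ∈ₗ xs → f a ≡ f b → a ≡ b) →
    (∀ {a} → a ∈ₗ xs → f a ∈ₗ ys) →
    length xs ≤ length ys
  length-≤-injection f []       _            _   _    = z≤n
  length-≤-injection f (x ∷ xs) {ys} (x∉xs ∷ xs!) inj into = begin
    suc (length xs)           ≤⟨ s≤s (length-≤-injection f xs xs! (λ a b → inj (there a) (there b)) into′) ⟩
    suc (length (ys ─ fx∈ys)) ≡⟨ length-removeAt′ ys (index fx∈ys) ⟨
    length ys                 ∎
    where
    open ≤-Reasoning
    fx∈ys : f x ∈ₗ ys
    fx∈ys = into (here refl)
    into′ : ∀ {a} → a ∈ₗ xs → f a ∈ₗ (ys ─ fx∈ys)
    into′ a∈xs = ∈-─⁺ fx∈ys (into (there a∈xs))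
      (λ fa≡fx → All.lookup x∉xs a∈xs (inj (here refl) (there a∈xs) (sym fa≡fx)))

  module _ {P : A → Set} (P? : Decidable P) where

    length-filter-∷ : ∀ x xs → length (filter P? xs) ≤ length (filter P? (x ∷ xs))
    length-filter-∷ x xs with P? x
    ... | yes _ = n≤1+n _
    ... | no  _ = ≤-refl

    length-filter-none : (∀ {x} → ¬ P x) → ∀ xs → length (filter P? xs) ≡ 0
    length-filter-none ∄P xs = cong length (filter-none P? (All.universal (λ _ → ∄P) xs))

  module _ {P Q R : A → Set} (P? : Decidable P) (Q? : Decidable Q) (R? : Decidable R)
           (P⇒Q⊎R : ∀ {x} → P x → Q x ⊎ R x) where

    length-filter-⊎ : ∀ xs → length (filter P? xs) ≤ length (filter Q? xs) + length (filter R? xs)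
    length-filter-⊎ []       = z≤n
    length-filter-⊎ (x ∷ xs) with P? x
    ... | no _   = ≤-trans (length-filter-⊎ xs) (+-mono-≤ (length-filter-∷ Q? x xs) (length-filter-∷ R? x xs))
    ... | yes px = counted (P⇒Q⊎R px)
      where
      counted : Q x ⊎ R x →
        suc (length (filter P? xs)) ≤ length (filter Q? (x ∷ xs)) + length (filter R? (x ∷ xs))
      counted (inj₁ qx) with Q? x
      ... | yes _  = s≤s (≤-trans (length-filter-⊎ xs) (+-monoʳ-≤ _ (length-filter-∷ R? x xs)))
      ... | no ¬qx = contradiction qx ¬qx
      counted (inj₂ rx) with R? x
      ... | yes _  = subst (suc (length (filter P? xs)) ≤_) (sym (+-suc (length (filter Q? (x ∷ xs))) _))
                       (s≤s (≤-trans (length-filter-⊎ xs) (+-monoˡ-≤ _ (length-filter-∷ Q? x xs))))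
      ... | no ¬rx = contradiction rx ¬rx

  length-filter-any : {I : Set} {P : I → A → Set} (P? : ∀ i → Decidable (P i))
    (g : I → ℕ) (is : List I) (xs : List A) →
    (∀ {i} → i ∈ₗ is → length (filter (P? i) xs) ≤ g i) →
    length (filter (λ x → any? (λ i → P? i x) is) xs) ≤ sum (map g is)
  length-filter-any P? g []       xs _ = ≤-reflexive (length-filter-none _ (λ ()) xs)
  length-filter-any P? g (i ∷ is) xs bound = ≤-trans
    (length-filter-⊎ (λ x → any? (λ j → P? j x) (i ∷ is)) (P? i) (λ x → any? (λ j → P? j x) is) Any.toSum xs)
    (+-mono-≤ (bound (here refl)) (length-filter-any P? g is xs (bound ∘ there)))

module _ {n : ℕ} where

  x∈p⇒0<∣p∣ : ∀ {p : Subset n} {x} → x ∈ p → 0 < ∣ p ∣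
  x∈p⇒0<∣p∣ {p} {x} x∈p = subst (_≤ ∣ p ∣) (∣⁅x⁆∣≡1 x)
    (p⊆q⇒∣p∣≤∣q∣ (λ y∈⁅x⁆ → subst (_∈ p) (sym (x∈⁅y⁆⇒x≡y x y∈⁅x⁆)) x∈p))

  ∣p∣≤1⇒subsingleton : ∀ {p : Subset n} → ∣ p ∣ ≤ 1 → ∀ {x y} → x ∈ p → y ∈ p → x ≡ y
  ∣p∣≤1⇒subsingleton {p} ∣p∣≤1 {x} {y} x∈p y∈p with x ≟ y
  ... | yes x≡y = x≡y
  ... | no  x≢y = contradiction (≤-<-trans 0<∣p-x∣ (<-≤-trans (x∈p⇒∣p-x∣<∣p∣ x∈p) ∣p∣≤1)) (<-irrefl refl)
    where
    0<∣p-x∣ : 0 < ∣ p - x ∣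
    0<∣p-x∣ = x∈p⇒0<∣p∣ (x∈p∧x≢y⇒x∈p-y y∈p (x≢y ∘ sym))

  subsingleton⇒∣p∣≤1 : ∀ {p : Subset n} → (∀ {x y} → x ∈ p → y ∈ p → x ≡ y) → ∣ p ∣ ≤ 1
  subsingleton⇒∣p∣≤1 {p} all-equal with nonempty? p
  ... | yes (x , x∈p) = subst (∣ p ∣ ≤_) (∣⁅x⁆∣≡1 x)
    (p⊆q⇒∣p∣≤∣q∣ (λ y∈p → subst (_∈ ⁅ x ⁆) (all-equal x∈p y∈p) (x∈⁅x⁆ x)))
  ... | no  empty = subst (_≤ 1) (sym (trans (cong ∣_∣ (Empty-unique empty)) (∣⊥∣≡0 n))) z≤n

module _ {n : ℕ} (G : Graph n) where
  open Graph G

  ∈N⇒adj : ∀ {x y} → y ∈ N G x → adj x y ≡ true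
  ∈N⇒adj {x} {y} y∈Nx = trans (sym (lookup∘tabulate (adj x) y)) ([]=⇒lookup y∈Nx)

  adj⇒∈N : ∀ {x y} → adj x y ≡ true → y ∈ N G x
  adj⇒∈N {x} {y} xy = lookup⇒[]= y (N G x) (trans (lookup∘tabulate (adj x) y) xy)

  ∈N-sym : ∀ {x y} → y ∈ N G x → x ∈ N G y
  ∈N-sym {x} {y} = adj⇒∈N ∘ trans (symm y x) ∘ ∈N⇒adj

  N⊆N[] : ∀ {x} → N G x ⊆ N[_] G x
  N⊆N[] = p⊆p∪q _

  x∈N[x] : ∀ x → x ∈ N[_] G x
  x∈N[x] x = q⊆p∪q (N G x) ⁅ x ⁆ (x∈⁅x⁆ x)

  ∈N[]⁻ : ∀ {x y} → y ∈ N[_] G x → y ∈ N G x ⊎ y ≡ x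
  ∈N[]⁻ {x} y∈N[x] with x∈p∪q⁻ (N G x) ⁅ x ⁆ y∈N[x]
  ... | inj₁ y∈Nx = inj₁ y∈Nx
  ... | inj₂ y∈⁅x⁆ = inj₂ (x∈⁅y⁆⇒x≡y x y∈⁅x⁆)

  ∈-allSubsets : ∀ {m} (F : Subset m) → F ∈ₗ allSubsets G m
  ∈-allSubsets []          = here refl
  ∈-allSubsets (inside ∷ F)  = ∈-++⁺ˡ (∈-map⁺ (inside ∷_) (∈-allSubsets F))
  ∈-allSubsets {suc m} (outside ∷ F) =
    ∈-++⁺ʳ (map (inside ∷_) (allSubsets G m)) (∈-map⁺ (outside ∷_) (∈-allSubsets F))

  allSubsets-unique : ∀ m → Unique (allSubsets G m)
  allSubsets-unique zero    = All.[] ∷ []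
  allSubsets-unique (suc m) =
    Unique.++⁺ (Unique.map⁺ ∷-injectiveʳ (allSubsets-unique m))
               (Unique.map⁺ ∷-injectiveʳ (allSubsets-unique m)) disjoint
    where
    disjoint : ∀ {F} → ¬ (F ∈ₗ map (inside ∷_) (allSubsets G m) × F ∈ₗ map (outside ∷_) (allSubsets G m))
    disjoint (F∈ins , F∈outs) with ∈-map⁻ (inside ∷_) F∈ins | ∈-map⁻ (outside ∷_) F∈outs
    ... | _ , _ , refl | _ , _ , ()

  IsDissociation : Subset n → Set
  IsDissociation F = ∀ {x a b} → x ∈ F → a ∈ F → b ∈ F → a ∈ N G x → b ∈ N G x → a ≡ b

  isDissociation-⊆ : ∀ {F F'} → F' ⊆ F → IsDissociation F → IsDissociation F'
  isDissociation-⊆ F'⊆F dF x∈F' a∈F' b∈F' = dF (F'⊆F x∈F') (F'⊆F a∈F') (F'⊆F b∈F')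

  dissociation⁻ : ∀ {W F} → Dissociation G W F → IsDissociation F
  dissociation⁻ (_ , deg≤1) x∈F a∈F b∈F a∈Nx b∈Nx =
    ∣p∣≤1⇒subsingleton (deg≤1 _ x∈F) (x∈p∩q⁺ (a∈F , a∈Nx)) (x∈p∩q⁺ (b∈F , b∈Nx))

  dissociation⁺ : ∀ {W F} → F ⊆ W → IsDissociation F → Dissociation G W F
  dissociation⁺ {F = F} F⊆W dF = F⊆W , λ x x∈F → subsingleton⇒∣p∣≤1 λ a∈ b∈ →
    let a∈F , a∈Nx = x∈p∩q⁻ F (N G x) a∈
        b∈F , b∈Nx = x∈p∩q⁻ F (N G x) b∈
    in dF x∈F a∈F b∈F a∈Nx b∈Nx

  maximalDissociation⁻ : ∀ {W F F'} → MaximalDissociation G W F → Dissociation G W F' → F ⊆ F' → F' ⊆ F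
  maximalDissociation⁻ {F' = F'} (_ , maximal) = All.lookup maximal (∈-allSubsets F')

  maximalDissociation⁺ : ∀ {W F} → Dissociation G W F →
    (∀ {F'} → Dissociation G W F' → F ⊆ F' → F' ⊆ F) → MaximalDissociation G W F
  maximalDissociation⁺ dF maximal = dF , All.tabulate (λ _ → maximal)

  maximal-absorbs : ∀ {F y} → MaximalDissociation G ⊤ F → IsDissociation (F ∪ ⁅ y ⁆) → y ∈ F
  maximal-absorbs {F} {y} F-max dF∪y =
    maximalDissociation⁻ F-max (dissociation⁺ ⊆⊤ dF∪y) (p⊆p∪q _) (q⊆p∪q F ⁅ y ⁆ (x∈⁅x⁆ y))

  isDissociation-∪ : ∀ {A B} → IsDissociation A → IsDissociation B →
    (∀ {x y} → x ∈ A → y ∈ B → y ∉ N G x) → IsDissociation (A ∪ B)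
  isDissociation-∪ {A} {B} dA dB sep x∈ a∈ b∈ a∈Nx b∈Nx with x∈p∪q⁻ A B x∈
  ... | inj₁ x∈A = dA x∈A (stays-in-A x∈A a∈ a∈Nx) (stays-in-A x∈A b∈ b∈Nx) a∈Nx b∈Nx
    where
    stays-in-A : ∀ {x a} → x ∈ A → a ∈ A ∪ B → a ∈ N G x → a ∈ A
    stays-in-A x∈A a∈ a∈Nx with x∈p∪q⁻ A B a∈
    ... | inj₁ a∈A = a∈A
    ... | inj₂ a∈B = contradiction a∈Nx (sep x∈A a∈B)
  ... | inj₂ x∈B = dB x∈B (stays-in-B x∈B a∈ a∈Nx) (stays-in-B x∈B b∈ b∈Nx) a∈Nx b∈Nx
    where
    stays-in-B : ∀ {x a} → x ∈ B → a ∈ A ∪ B → a ∈ N G x → a ∈ B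
    stays-in-B x∈B a∈ a∈Nx with x∈p∪q⁻ A B a∈
    ... | inj₁ a∈A = contradiction (∈N-sym a∈Nx) (sep a∈A x∈B)
    ... | inj₂ a∈B = a∈B

  isDissociation-∪⁅⁆ : ∀ {F y} → IsDissociation F → (∀ {a b} → a ∈ N G y → b ∈ N G y → a ≡ b) →
    (∀ {x a} → x ∈ F → y ∈ N G x → a ∈ F → a ∉ N G x) → IsDissociation (F ∪ ⁅ y ⁆)
  isDissociation-∪⁅⁆ {F} {y} dF deg-y≤1 isolated x∈ a∈ b∈ a∈Nx b∈Nx
    with x∈p∪q⁻ F ⁅ y ⁆ x∈ | x∈p∪q⁻ F ⁅ y ⁆ a∈ | x∈p∪q⁻ F ⁅ y ⁆ b∈
  ... | inj₂ x∈⁅y⁆ | _ | _ with refl ← x∈⁅y⁆⇒x≡y y x∈⁅y⁆ = deg-y≤1 a∈Nx b∈Nx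
  ... | inj₁ x∈F | inj₁ a∈F | inj₁ b∈F = dF x∈F a∈F b∈F a∈Nx b∈Nx
  ... | inj₁ x∈F | inj₂ a∈⁅y⁆ | inj₂ b∈⁅y⁆ = trans (x∈⁅y⁆⇒x≡y y a∈⁅y⁆) (sym (x∈⁅y⁆⇒x≡y y b∈⁅y⁆))
  ... | inj₁ x∈F | inj₂ a∈⁅y⁆ | inj₁ b∈F with refl ← x∈⁅y⁆⇒x≡y y a∈⁅y⁆ =
    contradiction b∈Nx (isolated x∈F a∈Nx b∈F)
  ... | inj₁ x∈F | inj₁ a∈F | inj₂ b∈⁅y⁆ with refl ← x∈⁅y⁆⇒x≡y y b∈⁅y⁆ =
    contradiction a∈Nx (isolated x∈F b∈Nx a∈F)

  restrict-maximal : ∀ {F W} → MaximalDissociation G ⊤ F →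
    (∀ {x y} → x ∈ F → x ∉ W → y ∈ W → y ∉ N G x) → MaximalDissociation G W (F ∩ W)
  restrict-maximal {F} {W} F-max sep =
    maximalDissociation⁺ (dissociation⁺ (p∩q⊆q F W) (isDissociation-⊆ (p∩q⊆p F W) dF)) maximal
    where
    dF : IsDissociation F
    dF = dissociation⁻ (proj₁ F-max)
    maximal : ∀ {F'} → Dissociation G W F' → F ∩ W ⊆ F' → F' ⊆ F ∩ W
    maximal {F'} dF' F∩W⊆F' y∈F' = x∈p∩q⁺ (F'⊆F y∈F' , proj₁ dF' y∈F')
      where
      -- F with its part inside W replaced by F' is again a dissociation set of G.
      H : Subset n
      H = (F ∩ ∁ W) ∪ F'
      dH : IsDissociation H
      dH = isDissociation-∪ (isDissociation-⊆ (p∩q⊆p F (∁ W)) dF) (dissociation⁻ dF') λ x∈ y∈F' →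
        let x∈F , x∈∁W = x∈p∩q⁻ F (∁ W) x∈ in sep x∈F (x∈∁p⇒x∉p x∈∁W) (proj₁ dF' y∈F')
      F⊆H : F ⊆ H
      F⊆H {x} x∈F with x ∈? W
      ... | yes x∈W = q⊆p∪q _ F' (F∩W⊆F' (x∈p∩q⁺ (x∈F , x∈W)))
      ... | no  x∉W = p⊆p∪q F' (x∈p∩q⁺ (x∈F , x∉p⇒x∈∁p x∉W))
      F'⊆F : F' ⊆ F
      F'⊆F = maximalDissociation⁻ F-max (dissociation⁺ ⊆⊤ dH) F⊆H ∘ q⊆p∪q _ F'

  count : {P : Subset n → Set} → Decidable P → ℕ
  count P? = length (filter P? (allSubsets G n))

  -- Restriction to W is injective on such sets F, since F ∖ W is the fixed set K ∖ W.
  count-≤-φ : ∀ (W K : Subset n) {P : Subset n → Set} (P? : Decidable P) →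
    (∀ {F} → P F → MaximalDissociation G ⊤ F) → (∀ {F} → P F → K ⊆ F) → (∀ {F} → P F → F ⊆ K ∪ W) →
    (∀ {x y} → x ∈ K → y ∈ W → y ∉ N G x) →
    count P? ≤ φ G W
  count-≤-φ W K {P} P? maximal K⊆ ⊆K∪W sep =
    length-≤-injection (_∩ W) (filter P? (allSubsets G n)) (Unique.filter⁺ P? (allSubsets-unique n))
      (λ F∈ F'∈ → injective (satisfies F∈) (satisfies F'∈))
      (λ F∈ → ∈-filter⁺ (maximalDissociation? G W) (∈-allSubsets _)
                (restrict-maximal (maximal (satisfies F∈)) (λ x∈F x∉W → sep (outside-W (satisfies F∈) x∈F x∉W))))
    where
    satisfies : ∀ {F} → F ∈ₗ filter P? (allSubsets G n) → P F
    satisfies = proj₂ ∘ ∈-filter⁻ P? {xs = allSubsets G n}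
    outside-W : ∀ {F x} → P F → x ∈ F → x ∉ W → x ∈ K
    outside-W pF x∈F x∉W with x∈p∪q⁻ K W (⊆K∪W pF x∈F)
    ... | inj₁ x∈K = x∈K
    ... | inj₂ x∈W = contradiction x∈W x∉W
    agree : ∀ {F F'} → P F → P F' → F ∩ W ≡ F' ∩ W → F ⊆ F'
    agree {F} {F'} pF pF' eq {x} x∈F with x ∈? W
    ... | yes x∈W = proj₁ (x∈p∩q⁻ F' W (subst (x ∈_) eq (x∈p∩q⁺ (x∈F , x∈W))))
    ... | no  x∉W = K⊆ pF' (outside-W pF x∈F x∉W)
    injective : ∀ {F F'} → P F → P F' → F ∩ W ≡ F' ∩ W → F ≡ F'
    injective pF pF' eq = ⊆-antisym (agree pF pF' eq) (agree pF' pF (sym eq))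

  MaximalContaining : Fin n → Fin n → Subset n → Set
  MaximalContaining p q F = MaximalDissociation G ⊤ F × p ∈ F × q ∈ F

  maximalContaining? : ∀ p q → Decidable (MaximalContaining p q)
  maximalContaining? p q F = maximalDissociation? G ⊤ F ×-dec (p ∈? F ×-dec q ∈? F)

  count-containing-edge : ∀ {p q} → q ∈ N G p → count (maximalContaining? p q) ≤ φ-del G (N[_] G p ∪ N[_] G q)
  count-containing-edge {p} {q} q∈Np = count-≤-φ (∁ S) (⁅ p ⁆ ∪ ⁅ q ⁆) (maximalContaining? p q)
    proj₁ K⊆F F⊆K∪W sep
    where
    S : Subset n
    S = N[_] G p ∪ N[_] G q
    K⊆F : ∀ {F} → MaximalContaining p q F → ⁅ p ⁆ ∪ ⁅ q ⁆ ⊆ F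
    K⊆F {F} (_ , p∈F , q∈F) x∈K with x∈p∪q⁻ ⁅ p ⁆ ⁅ q ⁆ x∈K
    ... | inj₁ x∈⁅p⁆ = subst (_∈ F) (sym (x∈⁅y⁆⇒x≡y p x∈⁅p⁆)) p∈F
    ... | inj₂ x∈⁅q⁆ = subst (_∈ F) (sym (x∈⁅y⁆⇒x≡y q x∈⁅q⁆)) q∈F
    -- p and q already are each other's unique neighbour in F.
    in-K : ∀ {F x} → MaximalContaining p q F → x ∈ F → x ∈ S → x ∈ ⁅ p ⁆ ∪ ⁅ q ⁆
    in-K {F} {x} (F-max , p∈F , q∈F) x∈F x∈S = x∈p∪q⁺ (is-p-or-q (x∈p∪q⁻ (N[_] G p) (N[_] G q) x∈S))
      where
      dF : IsDissociation F
      dF = dissociation⁻ (proj₁ F-max)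
      is-p-or-q : x ∈ N[_] G p ⊎ x ∈ N[_] G q → x ∈ ⁅ p ⁆ ⊎ x ∈ ⁅ q ⁆
      is-p-or-q (inj₁ x∈N[p]) with ∈N[]⁻ x∈N[p]
      ... | inj₁ x∈Np = inj₂ (subst (_∈ ⁅ q ⁆) (sym (dF p∈F x∈F q∈F x∈Np q∈Np)) (x∈⁅x⁆ q))
      ... | inj₂ refl = inj₁ (x∈⁅x⁆ p)
      is-p-or-q (inj₂ x∈N[q]) with ∈N[]⁻ x∈N[q]
      ... | inj₁ x∈Nq = inj₁ (subst (_∈ ⁅ p ⁆) (sym (dF q∈F x∈F p∈F x∈Nq (∈N-sym q∈Np))) (x∈⁅x⁆ p))
      ... | inj₂ refl = inj₂ (x∈⁅x⁆ q)
    F⊆K∪W : ∀ {F} → MaximalContaining p q F → F ⊆ (⁅ p ⁆ ∪ ⁅ q ⁆) ∪ ∁ S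
    F⊆K∪W pF {x} x∈F with x ∈? S
    ... | yes x∈S = p⊆p∪q (∁ S) (in-K pF x∈F x∈S)
    ... | no  x∉S = q⊆p∪q _ (∁ S) (x∉p⇒x∈∁p x∉S)
    sep : ∀ {x y} → x ∈ ⁅ p ⁆ ∪ ⁅ q ⁆ → y ∈ ∁ S → y ∉ N G x
    sep x∈K y∈∁S y∈Nx with x∈p∪q⁻ ⁅ p ⁆ ⁅ q ⁆ x∈K
    ... | inj₁ x∈⁅p⁆ with refl ← x∈⁅y⁆⇒x≡y p x∈⁅p⁆ = x∈∁p⇒x∉p y∈∁S (p⊆p∪q (N[_] G q) (N⊆N[] y∈Nx))
    ... | inj₂ x∈⁅q⁆ with refl ← x∈⁅y⁆⇒x≡y q x∈⁅q⁆ = x∈∁p⇒x∉p y∈∁S (q⊆p∪q (N[_] G p) _ (N⊆N[] y∈Nx))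

  MaximalAvoiding : Fin n → Subset n → Set
  MaximalAvoiding p F = MaximalDissociation G ⊤ F × p ∉ F

  maximalAvoiding? : ∀ p → Decidable (MaximalAvoiding p)
  maximalAvoiding? p F = maximalDissociation? G ⊤ F ×-dec ¬? (p ∈? F)

  module Leaf {v w : Fin n} (Nv≡⁅w⁆ : N G v ≡ ⁅ w ⁆) where

    ∈Nv⇒≡w : ∀ {y} → y ∈ N G v → y ≡ w
    ∈Nv⇒≡w {y} y∈Nv = x∈⁅y⁆⇒x≡y w (subst (y ∈_) Nv≡⁅w⁆ y∈Nv)

    v∈Nw : v ∈ N G w
    v∈Nw = ∈N-sym (subst (w ∈_) (sym Nv≡⁅w⁆) (x∈⁅x⁆ w))

    otherNeighbours : List (Fin n)
    otherNeighbours = filter (λ u → (adj w u ≟ᵇ true) ×-dec ¬? (u ≟ v)) (allFin n)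

    adjoin-v : ∀ {F} → IsDissociation F → (∀ {a} → w ∈ F → a ∈ F → a ∉ N G w) → IsDissociation (F ∪ ⁅ v ⁆)
    adjoin-v {F} dF w-isolated =
      isDissociation-∪⁅⁆ dF (λ a∈Nv b∈Nv → trans (∈Nv⇒≡w a∈Nv) (sym (∈Nv⇒≡w b∈Nv))) isolated
      where
      isolated : ∀ {x a} → x ∈ F → v ∈ N G x → a ∈ F → a ∉ N G x
      isolated x∈F v∈Nx with refl ← ∈Nv⇒≡w (∈N-sym v∈Nx) = w-isolated x∈F

    v∈F-if-w∉F : ∀ {F} → MaximalDissociation G ⊤ F → w ∉ F → v ∈ F
    v∈F-if-w∉F F-max w∉F =
      maximal-absorbs F-max (adjoin-v (dissociation⁻ (proj₁ F-max)) (λ w∈F → contradiction w∈F w∉F))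

    other-neighbour-in : ∀ {F} → MaximalDissociation G ⊤ F → w ∈ F → v ∉ F → Any (_∈ F) otherNeighbours
    other-neighbour-in {F} F-max w∈F v∉F with any? (_∈? F) otherNeighbours
    ... | yes found = found
    ... | no  none  = contradiction (maximal-absorbs F-max (adjoin-v (dissociation⁻ (proj₁ F-max)) w-isolated)) v∉F
      where
      w-isolated : ∀ {a} → w ∈ F → a ∈ F → a ∉ N G w
      w-isolated {a} _ a∈F a∈Nw = none (Any.map (λ a≡u → subst (_∈ F) a≡u a∈F)
        (∈-filter⁺ _ (∈-allFin a) (∈N⇒adj a∈Nw , λ a≡v → v∉F (subst (_∈ F) a≡v a∈F))))

    classify : ∀ {F} → MaximalDissociation G ⊤ F →
      (Any (λ u → MaximalContaining w u F) otherNeighbours ⊎ MaximalAvoiding w F) ⊎ MaximalContaining w v F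
    classify {F} F-max with w ∈? F | v ∈? F
    ... | no  w∉F | _       = inj₁ (inj₂ (F-max , w∉F))
    ... | yes w∈F | yes v∈F = inj₂ (F-max , w∈F , v∈F)
    ... | yes w∈F | no  v∉F =
      inj₁ (inj₁ (Any.map (λ u∈F → F-max , w∈F , u∈F) (other-neighbour-in F-max w∈F v∉F)))

    count-containing-other : ∀ {u} → u ∈ₗ otherNeighbours →
      count (maximalContaining? w u) ≤ φ-del G (N[_] G w ∪ N[_] G u)
    count-containing-other u∈ = count-containing-edge (adj⇒∈N (proj₁ (proj₂ (∈-filter⁻ _ {xs = allFin n} u∈))))

    count-avoiding-w : count (maximalAvoiding? w) ≤ φ-del G (⁅ v ⁆ ∪ ⁅ w ⁆)
    count-avoiding-w = count-≤-φ (∁ (⁅ v ⁆ ∪ ⁅ w ⁆)) ⁅ v ⁆ (maximalAvoiding? w) proj₁ ⁅v⁆⊆F F⊆K∪W sep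
      where
      ⁅v⁆⊆F : ∀ {F} → MaximalAvoiding w F → ⁅ v ⁆ ⊆ F
      ⁅v⁆⊆F {F} (F-max , w∉F) x∈⁅v⁆ = subst (_∈ F) (sym (x∈⁅y⁆⇒x≡y v x∈⁅v⁆)) (v∈F-if-w∉F F-max w∉F)
      F⊆K∪W : ∀ {F} → MaximalAvoiding w F → F ⊆ ⁅ v ⁆ ∪ ∁ (⁅ v ⁆ ∪ ⁅ w ⁆)
      F⊆K∪W {F} (_ , w∉F) {x} x∈F with x ∈? (⁅ v ⁆ ∪ ⁅ w ⁆)
      ... | no  x∉S = q⊆p∪q ⁅ v ⁆ _ (x∉p⇒x∈∁p x∉S)
      ... | yes x∈S with x∈p∪q⁻ ⁅ v ⁆ ⁅ w ⁆ x∈S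
      ...   | inj₁ x∈⁅v⁆ = p⊆p∪q _ x∈⁅v⁆
      ...   | inj₂ x∈⁅w⁆ = contradiction (subst (_∈ F) (x∈⁅y⁆⇒x≡y w x∈⁅w⁆) x∈F) w∉F
      sep : ∀ {x y} → x ∈ ⁅ v ⁆ → y ∈ ∁ (⁅ v ⁆ ∪ ⁅ w ⁆) → y ∉ N G x
      sep x∈⁅v⁆ y∈∁S y∈Nx with refl ← x∈⁅y⁆⇒x≡y v x∈⁅v⁆ with refl ← ∈Nv⇒≡w y∈Nx =
        x∈∁p⇒x∉p y∈∁S (q⊆p∪q ⁅ v ⁆ _ (x∈⁅x⁆ w))

    N[v]⊆N[w] : N[_] G v ⊆ N[_] G w
    N[v]⊆N[w] x∈N[v] with ∈N[]⁻ x∈N[v]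
    ... | inj₁ x∈Nv with refl ← ∈Nv⇒≡w x∈Nv = x∈N[x] w
    ... | inj₂ refl = N⊆N[] v∈Nw

    count-containing-w-v : count (maximalContaining? w v) ≤ φ-del G (N[_] G w)
    count-containing-w-v = subst (λ S → count (maximalContaining? w v) ≤ φ-del G S)
      (⊆-antisym (λ x∈ → [ id , N[v]⊆N[w] ]′ (x∈p∪q⁻ (N[_] G w) _ x∈)) (p⊆p∪q _))
      (count-containing-edge v∈Nw)

lemma2p3 : {n : ℕ} (G : Graph n) (v w : Fin n) →
    degree G v ≡ 1 → N G v ≡ ⁅ w ⁆ →
    φ G ⊤ ≤
      sum (map (λ u → φ-del G (N[_] G w ∪ N[_] G u))
               (filter (λ u → (Graph.adj G w u ≟ᵇ true) ×-dec ¬? (u ≟ v)) (allFin n)))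
      + φ-del G (⁅ v ⁆ ∪ ⁅ w ⁆)
      + φ-del G (N[_] G w)
-- The degree hypothesis is implied by N v ≡ ⁅ w ⁆.
lemma2p3 {n} G v w _ Nv≡⁅w⁆ = begin
  φ G ⊤
    ≤⟨ length-filter-⊎ _ containing-other-or-avoiding? (maximalContaining? G w v) classify subsets ⟩
  count G containing-other-or-avoiding? + count G (maximalContaining? G w v)
    ≤⟨ +-monoˡ-≤ _ (length-filter-⊎ _ containing-other? (maximalAvoiding? G w) id subsets) ⟩
  count G containing-other? + count G (maximalAvoiding? G w) + count G (maximalContaining? G w v)
    ≤⟨ +-mono-≤ (+-mono-≤ (length-filter-any (maximalContaining? G w) _ otherNeighbours subsets count-containing-other)
                          count-avoiding-w)
                count-containing-w-v ⟩
  sum (map (λ u → φ-del G (N[_] G w ∪ N[_] G u)) otherNeighbours) + φ-del G (⁅ v ⁆ ∪ ⁅ w ⁆) + φ-del G (N[_] G w) ∎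
  where
  open Leaf G Nv≡⁅w⁆
  open ≤-Reasoning
  subsets : List (Subset n)
  subsets = allSubsets G n
  containing-other? : Decidable (λ F → Any (λ u → MaximalContaining G w u F) otherNeighbours)
  containing-other? F = any? (λ u → maximalContaining? G w u F) otherNeighbours
  containing-other-or-avoiding? : Decidable (λ F → Any (λ u → MaximalContaining G w u F) otherNeighbours ⊎ MaximalAvoiding G w F)
  containing-other-or-avoiding? F = containing-other? F ⊎-dec maximalAvoiding? G w F
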